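{- Let $M$ be a matroid on a finite ground set $E$ with collection of bases $\mathcal{B}$, let $M^\ast$ be its dual matroid with collection of independent sets $\mathcal{I}^\ast$, and let $\preceq$ be a total order on $E$. Then the BDD $\mathsf{B}(\mathcal{I}^\ast)$ with respect to $(E,\preceq)$ is obtained from the ZDD $\mathsf{Z}(\mathcal{B})$ with respect to $(E,\preceq)$ by setting $(\nu_0,\nu_1)\gets(\nu_1,\nu_0)$ (swapping the 0-arc and 1-arc) at every non-terminal node $\nu$.
   Context: The dual $M^\ast$ of $M$ has ground set $E$ and bases $\{E\setminus B: B\in\mathcal{B}\}$. A decision diagram over $(E,\preceq)$ is a directed acyclic graph with a unique root, at most two terminal nodes, the 0-terminal $\bot$ and the 1-terminal $\top$, and non-terminal nodes $\nu$, each with a label $\ell(\nu)\in E$ and exactly two outgoing arcs, the 0-arc $(\nu,\nu_0)$ and the 1-arc $(\nu,\nu_1)$, with $\ell(\nu)\prec\ell(\nu_0),\ell(\nu_1)$ (terminal labels regarded as larger than all elements of $E$). A 1-path is a directed path from the root to $\top$. Under BDD semantics a 1-path represents all $X\subseteq E$ containing the label of the tail of every 1-arc on the path and no label of the tail of any 0-arc on the path; under ZDD semantics it represents the single set of labels of tails of the 1-arcs on the path; the diagram represents the union. The BDD $\mathsf{B}(\mathcal{S})$ (resp. ZDD $\mathsf{Z}(\mathcal{S})$) of $\mathcal{S}\subseteq 2^E$ is the unique diagram obtained from the complete binary decision tree of $\mathcal{S}$ (internal nodes at depth $j$ labeled by the $(j+1)$-th smallest element of $E$; the leaf reached by taking 1-arcs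 exactly at the elements of $X$ is $\top$ iff $X\in\mathcal{S}$, else $\bot$) by exhaustively applying: (NS) merge non-terminal nodes with the same label, same 0-successor and same 1-successor; and for BDDs (B-ND) remove every non-terminal $\nu$ with $\nu_0=\nu_1$, redirecting arcs entering $\nu$ to $\nu_0$; for ZDDs (Z-ND) remove every non-terminal $\nu$ with $\nu_1=\bot$, redirecting arcs entering $\nu$ to $\nu_0$. -}

module Defs where

open import Data.Bool using (Bool; true; false; T; if_then_else_)
open import Data.Nat using (ℕ; zero; suc)
open import Data.Fin using (Fin)
import Data.Fin as F
open import Data.Fin.Subset using (Subset; _∈_; _∉_; _⊆_; ∁; _∪_; _-_; ⁅_⁆)
open import Data.Fin.Subset.Properties using (_⊆?_; anySubset?)
open import Data.Vec using ([]; _∷_)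
open import Data.Product using (Σ; ∃; _×_; _,_)
open import Relation.Nullary using (Dec; yes; no)
open import Relation.Nullary.Decidable using (⌊_⌋)
open import Data.Bool.Properties using () renaming (_≟_ to _≟B_)
open import Relation.Binary.PropositionalEquality using (_≡_; refl; cong)
open import Data.Fin.Properties using () renaming (_≟_ to _≟F_)

-- Ground set E = Fin n, totally ordered by the natural order of Fin n
-- (any finite totally ordered set is order-isomorphic to such a Fin n).

Family : ℕ → Set
Family n = Subset n → Bool

record Matroid (n : ℕ) : Set where
  field
    isBasis  : Family n
    nonempty : ∃ λ B → T (isBasis B)
    exchange : ∀ B₁ B₂ → T (isBasis B₁) → T (isBasis B₂) →
               ∀ x → x ∈ B₁ → x ∉ B₂ →
               ∃ λ y → y ∈ B₂ × y ∉ B₁ × T (isBasis ((B₁ - x) ∪ ⁅ y ⁆))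
open Matroid public

dualBases : ∀ {n} → Matroid n → Family n
dualBases M X = isBasis M (∁ X)

independentOf : ∀ {n} → Family n → Family n
independentOf 𝓑 X = ⌊ anySubset? {P = λ B → T (𝓑 B) × X ⊆ B} dec ⌋
  where
  dec : ∀ B → Dec (T (𝓑 B) × X ⊆ B)
  dec B with 𝓑 B | X ⊆? B
  ... | true  | yes p = yes (_ , p)
  ... | true  | no ¬p = no λ { (_ , p) → ¬p p }
  ... | false | _     = no λ { (() , _) }

dualIndependent : ∀ {n} → Matroid n → Family n
dualIndependent M = independentOf (dualBases M)

-- A diagram in which no two distinct non-terminal nodes have the same
-- label, 0-successor and 1-successor (i.e. (NS)-reduced, as all BDDs/ZDDs
-- and their arc-swapped versions are) is determined up to isomorphism by
-- its unfolding from the root; we represent such diagrams by these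
-- unfoldings, node identity = structural equality of sub-diagrams.

data DD (n : ℕ) : Set where
  ⊥ᵈ ⊤ᵈ : DD n
  node  : (label : Fin n) (zero-child one-child : DD n) → DD n

_≟DD_ : ∀ {n} (a b : DD n) → Bool
⊥ᵈ ≟DD ⊥ᵈ = true
⊤ᵈ ≟DD ⊤ᵈ = true
node l a₀ a₁ ≟DD node m b₀ b₁ with l ≟F m
... | yes _ = if a₀ ≟DD b₀ then (a₁ ≟DD b₁) else false
... | no _  = false
_ ≟DD _ = false

relabel : ∀ {n} → DD n → DD (suc n)
relabel ⊥ᵈ = ⊥ᵈ
relabel ⊤ᵈ = ⊤ᵈ
relabel (node l a b) = node (F.suc l) (relabel a) (relabel b)

-- Complete binary decision tree of S: nodes at depth j labelled by the
-- (j+1)-th smallest element j of Fin n; the leaf reached by taking 1-arcs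
-- exactly at the elements of X is ⊤ iff X ∈ S.
completeTree : ∀ {n} → Family n → DD n
completeTree {zero}  S = if S [] then ⊤ᵈ else ⊥ᵈ
completeTree {suc n} S =
  node F.zero (relabel (completeTree (λ X → S (false ∷ X))))
              (relabel (completeTree (λ X → S (true ∷ X))))

-- Exhaustive application of (NS) (implicit in the representation) and
-- (B-ND): remove ν with ν₀ = ν₁.
reduceB : ∀ {n} → DD n → DD n
reduceB ⊥ᵈ = ⊥ᵈ
reduceB ⊤ᵈ = ⊤ᵈ
reduceB (node l a b) with reduceB a | reduceB b
... | a' | b' = if a' ≟DD b' then a' else node l a' b'

-- Exhaustive application of (NS) and (Z-ND): remove ν with ν₁ = ⊥.
reduceZ : ∀ {n} → DD n → DD n
reduceZ ⊥ᵈ = ⊥ᵈ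
reduceZ ⊤ᵈ = ⊤ᵈ
reduceZ (node l a b) with reduceZ a | reduceZ b
... | a' | ⊥ᵈ = a'
... | a' | b' = node l a' b'

BDD : ∀ {n} → Family n → DD n
BDD S = reduceB (completeTree S)

ZDD : ∀ {n} → Family n → DD n
ZDD S = reduceZ (completeTree S)

swapArcs : ∀ {n} → DD n → DD n
swapArcs ⊥ᵈ = ⊥ᵈ
swapArcs ⊤ᵈ = ⊤ᵈ
swapArcs (node l a b) = node l (swapArcs b) (swapArcs a)

-- Split both diagrams at the smallest element 0 of E. Write 𝓑₀, 𝓑₁ for the
-- bases avoiding / containing 0 (with 0 removed) and 𝓘₀, 𝓘₁ likewise for the
-- coindependent sets. The 1-branch 𝓘₁ of B(𝓘) is always the coindependence family
-- of 𝓑₀, the 0-branch of Z(𝓑). If some basis contains 0, basis exchange shows that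
-- 𝓘₀ is the coindependence family of 𝓑₁, so the 0-branch of B(𝓘) is the swapped
-- 1-branch of Z(𝓑); the two branches differ since B and B ∪ {0} are never both
-- bases. If no basis contains 0, Z(𝓑) drops its 0-node while 𝓘₀ = 𝓘₁, so B(𝓘)
-- drops it too.
module Submission where

open import Defs
open import Data.Nat using (ℕ)
open import Relation.Binary.PropositionalEquality using (_≡_)

open import Data.Bool using (Bool; true; false; T; if_then_else_)
open import Data.Bool.Properties using (T?; ⇔→≡; ∨-identityʳ)
open import Data.Nat using (zero; suc; _<_)
open import Data.Nat.Induction using (<-wellFounded)
open import Data.Nat.Properties using (≤-<-trans)
import Data.Fin as F
open import Data.Fin using (Fin)
open import Data.Fin.Properties using () renaming (_≟_ to _≟F_)
open import Data.Fin.Subset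
  using (Subset; _∈_; _∉_; _⊆_; ∁; _∪_; _∩_; _-_; _─_; ⁅_⁆; ∣_∣)
open import Data.Fin.Subset.Properties
  using (anySubset?; nonempty?; drop-there; drop-∷-⊆; out⊆; s⊆s; p⊆q⇒∣p∣≤∣q∣; x∈p⇒∣p-x∣<∣p∣;
         x∈p∪q⁺; x∈p∪q⁻; x∈p∩q⁺; x∈p∩q⁻; x∈p∧x≢y⇒x∈p-y; p─q⊆p; x∈⁅y⁆⇒x≡y;
         x∉⁅y⁆⇒x≢y; x∈p⇒x∉∁p; x∉p⇒x∈∁p; x∈∁p⇒x∉p; x∉∁p⇒x∈p; p⊆q⇒∁p⊇∁q;
         ∪-∩-booleanAlgebra)
open import Algebra.Lattice.Properties.BooleanAlgebra using (¬-involutive)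
open import Data.Vec using ([]; _∷_; here; there)
open import Data.Product using (∃; _×_; _,_; proj₁; proj₂)
open import Data.Sum using (inj₁; inj₂)
open import Data.Empty using (⊥-elim)
open import Data.Unit using (tt)
open import Function using (_∘_)
open import Function.Bundles using (_⇔_; mk⇔; Equivalence)
open import Induction.WellFounded using (Acc; acc)
open import Relation.Nullary using (¬_; yes; no)
open import Relation.Nullary.Decidable using (toWitness; fromWitness)
open import Relation.Binary.PropositionalEquality
  using (_≢_; refl; sym; trans; cong; cong₂; subst; module ≡-Reasoning)

open Equivalence using (to; from)
open ≡-Reasoning

private
  variable
    n : ℕ

T-⇔⇒≡ : ∀ {a b : Bool} → T a ⇔ T b → a ≡ b
T-⇔⇒≡ {false} {false} _ = refl
T-⇔⇒≡ {true}  {true}  _ = refl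
T-⇔⇒≡ {true}  {false} e = ⊥-elim (to e tt)
T-⇔⇒≡ {false} {true}  e = ⊥-elim (from e tt)

x∈p─q⇒x∉q : ∀ (p q : Subset n) {x} → x ∈ p ─ q → x ∉ q
x∈p─q⇒x∉q (_ ∷ p) (true  ∷ q) ()          here
x∈p─q⇒x∉q (_ ∷ p) (_     ∷ q) (there x∈) (there x∈q) = x∈p─q⇒x∉q p q x∈ x∈q

≟DD-refl : ∀ (a : DD n) → (a ≟DD a) ≡ true
≟DD-refl ⊥ᵈ = refl
≟DD-refl ⊤ᵈ = refl
≟DD-refl (node l a b) with l ≟F l
... | yes _ rewrite ≟DD-refl a | ≟DD-refl b = refl
... | no l≢l = ⊥-elim (l≢l refl)

≟DD-sound : ∀ (a b : DD n) → (a ≟DD b) ≡ true → a ≡ b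
≟DD-sound ⊥ᵈ ⊥ᵈ _ = refl
≟DD-sound ⊤ᵈ ⊤ᵈ _ = refl
≟DD-sound (node l a₀ a₁) (node m b₀ b₁) e with l ≟F m
... | yes refl with a₀ ≟DD b₀ in e₀
...   | true = cong₂ (node l) (≟DD-sound a₀ b₀ e₀) (≟DD-sound a₁ b₁ e)
≟DD-sound ⊥ᵈ ⊤ᵈ ()
≟DD-sound ⊥ᵈ (node _ _ _) ()
≟DD-sound ⊤ᵈ ⊥ᵈ ()
≟DD-sound ⊤ᵈ (node _ _ _) ()
≟DD-sound (node _ _ _) ⊥ᵈ ()
≟DD-sound (node _ _ _) ⊤ᵈ ()

≟DD-≡ : ∀ (a b : DD n) → (a ≟DD b) ≡ true ⇔ a ≡ b
≟DD-≡ a b = mk⇔ (≟DD-sound a b) λ { refl → ≟DD-refl a }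

-- Left inverse of relabel; nodes labelled 0 are not in its image and go to ⊥ᵈ.
unrelabel : DD (suc n) → DD n
unrelabel ⊥ᵈ = ⊥ᵈ
unrelabel ⊤ᵈ = ⊤ᵈ
unrelabel (node F.zero _ _) = ⊥ᵈ
unrelabel (node (F.suc l) a b) = node l (unrelabel a) (unrelabel b)

unrelabel-relabel : ∀ (a : DD n) → unrelabel (relabel a) ≡ a
unrelabel-relabel ⊥ᵈ = refl
unrelabel-relabel ⊤ᵈ = refl
unrelabel-relabel (node l a b) = cong₂ (node l) (unrelabel-relabel a) (unrelabel-relabel b)

relabel-injective : ∀ (a b : DD n) → relabel a ≡ relabel b → a ≡ b
relabel-injective a b e = begin
  a                     ≡⟨ unrelabel-relabel a ⟨
  unrelabel (relabel a) ≡⟨ cong unrelabel e ⟩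
  unrelabel (relabel b) ≡⟨ unrelabel-relabel b ⟩
  b                     ∎

≟DD-relabel : ∀ (a b : DD n) → (relabel a ≟DD relabel b) ≡ (a ≟DD b)
≟DD-relabel a b = ⇔→≡ (mk⇔
  (from (≟DD-≡ a b) ∘ relabel-injective a b ∘ to (≟DD-≡ (relabel a) (relabel b)))
  (from (≟DD-≡ (relabel a) (relabel b)) ∘ cong relabel ∘ to (≟DD-≡ a b)))

swapArcs-involutive : ∀ (a : DD n) → swapArcs (swapArcs a) ≡ a
swapArcs-involutive ⊥ᵈ = refl
swapArcs-involutive ⊤ᵈ = refl
swapArcs-involutive (node l a b) = cong₂ (node l) (swapArcs-involutive a) (swapArcs-involutive b)

swapArcs-injective : ∀ (a b : DD n) → swapArcs a ≡ swapArcs b → a ≡ b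
swapArcs-injective a b e = begin
  a                     ≡⟨ swapArcs-involutive a ⟨
  swapArcs (swapArcs a) ≡⟨ cong swapArcs e ⟩
  swapArcs (swapArcs b) ≡⟨ swapArcs-involutive b ⟩
  b                     ∎

swapArcs-relabel : ∀ (a : DD n) → swapArcs (relabel a) ≡ relabel (swapArcs a)
swapArcs-relabel ⊥ᵈ = refl
swapArcs-relabel ⊤ᵈ = refl
swapArcs-relabel (node l a b) = cong₂ (node (F.suc l)) (swapArcs-relabel b) (swapArcs-relabel a)

zNode : Fin n → DD n → DD n → DD n
zNode l a ⊥ᵈ = a
zNode l a ⊤ᵈ = node l a ⊤ᵈ
zNode l a (node m b₀ b₁) = node l a (node m b₀ b₁)

bNode : Fin n → DD n → DD n → DD n
bNode l a b = if a ≟DD b then a else node l a b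

reduceZ-node : ∀ (l : Fin n) a b → reduceZ (node l a b) ≡ zNode l (reduceZ a) (reduceZ b)
reduceZ-node l a b with reduceZ a | reduceZ b
... | _ | ⊥ᵈ = refl
... | _ | ⊤ᵈ = refl
... | _ | node _ _ _ = refl

zNode-nonempty : ∀ (l : Fin n) a b → b ≢ ⊥ᵈ → zNode l a b ≡ node l a b
zNode-nonempty l a ⊥ᵈ b≢⊥ = ⊥-elim (b≢⊥ refl)
zNode-nonempty l a ⊤ᵈ _ = refl
zNode-nonempty l a (node _ _ _) _ = refl

bNode-same : ∀ (l : Fin n) a → bNode l a a ≡ a
bNode-same l a rewrite ≟DD-refl a = refl

bNode-distinct : ∀ (l : Fin n) a b → a ≢ b → bNode l a b ≡ node l a b
bNode-distinct l a b a≢b with a ≟DD b in e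
... | true  = ⊥-elim (a≢b (≟DD-sound a b e))
... | false = refl

zNode-relabel : ∀ (l : Fin n) a b → zNode (F.suc l) (relabel a) (relabel b) ≡ relabel (zNode l a b)
zNode-relabel l a ⊥ᵈ = refl
zNode-relabel l a ⊤ᵈ = refl
zNode-relabel l a (node _ _ _) = refl

bNode-relabel : ∀ (l : Fin n) a b → bNode (F.suc l) (relabel a) (relabel b) ≡ relabel (bNode l a b)
bNode-relabel l a b rewrite ≟DD-relabel a b with a ≟DD b
... | true  = refl
... | false = refl

reduceZ-relabel : ∀ (t : DD n) → reduceZ (relabel t) ≡ relabel (reduceZ t)
reduceZ-relabel ⊥ᵈ = refl
reduceZ-relabel ⊤ᵈ = refl
reduceZ-relabel (node l a b) = begin
  reduceZ (node (F.suc l) (relabel a) (relabel b))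
    ≡⟨ reduceZ-node (F.suc l) (relabel a) (relabel b) ⟩
  zNode (F.suc l) (reduceZ (relabel a)) (reduceZ (relabel b))
    ≡⟨ cong₂ (zNode (F.suc l)) (reduceZ-relabel a) (reduceZ-relabel b) ⟩
  zNode (F.suc l) (relabel (reduceZ a)) (relabel (reduceZ b))
    ≡⟨ zNode-relabel l (reduceZ a) (reduceZ b) ⟩
  relabel (zNode l (reduceZ a) (reduceZ b))
    ≡⟨ cong relabel (reduceZ-node l a b) ⟨
  relabel (reduceZ (node l a b)) ∎

reduceB-relabel : ∀ (t : DD n) → reduceB (relabel t) ≡ relabel (reduceB t)
reduceB-relabel ⊥ᵈ = refl
reduceB-relabel ⊤ᵈ = refl
reduceB-relabel (node l a b) = begin
  bNode (F.suc l) (reduceB (relabel a)) (reduceB (relabel b))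
    ≡⟨ cong₂ (bNode (F.suc l)) (reduceB-relabel a) (reduceB-relabel b) ⟩
  bNode (F.suc l) (relabel (reduceB a)) (relabel (reduceB b))
    ≡⟨ bNode-relabel l (reduceB a) (reduceB b) ⟩
  relabel (bNode l (reduceB a) (reduceB b)) ∎

cofactor : Bool → Family (suc n) → Family n
cofactor b 𝓢 X = 𝓢 (b ∷ X)

ZDD-cofactors : ∀ (𝓢 : Family (suc n)) →
  ZDD 𝓢 ≡ zNode F.zero (relabel (ZDD (cofactor false 𝓢))) (relabel (ZDD (cofactor true 𝓢)))
ZDD-cofactors 𝓢 = trans (reduceZ-node F.zero (relabel t₀) (relabel t₁))
                        (cong₂ (zNode F.zero) (reduceZ-relabel t₀) (reduceZ-relabel t₁))
  where
  t₀ = completeTree (cofactor false 𝓢)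
  t₁ = completeTree (cofactor true 𝓢)

BDD-cofactors : ∀ (𝓢 : Family (suc n)) →
  BDD 𝓢 ≡ bNode F.zero (relabel (BDD (cofactor false 𝓢))) (relabel (BDD (cofactor true 𝓢)))
BDD-cofactors 𝓢 = cong₂ (bNode F.zero) (reduceB-relabel (completeTree (cofactor false 𝓢)))
                                      (reduceB-relabel (completeTree (cofactor true 𝓢)))

ZDD-empty : ∀ (𝓢 : Family n) → (∀ X → ¬ T (𝓢 X)) → ZDD 𝓢 ≡ ⊥ᵈ
ZDD-empty {zero} 𝓢 none with 𝓢 [] | none []
... | false | _ = refl
... | true  | ¬t = ⊥-elim (¬t tt)
ZDD-empty {suc n} 𝓢 none rewrite ZDD-cofactors 𝓢
  | ZDD-empty (cofactor false 𝓢) (none ∘ (false ∷_))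
  | ZDD-empty (cofactor true 𝓢) (none ∘ (true ∷_)) = refl

-- Inverts the root decomposition of ZDD-cofactors: a root labelled 0 has a
-- non-⊥ 1-branch, any other root is a bare 0-branch.
zSplit : DD (suc n) → DD (suc n) × DD (suc n)
zSplit (node F.zero a b) = a , b
zSplit t = t , ⊥ᵈ

zSplit-zNode : ∀ (a b : DD n) → zSplit (zNode F.zero (relabel a) (relabel b)) ≡ (relabel a , relabel b)
zSplit-zNode ⊥ᵈ ⊥ᵈ = refl
zSplit-zNode ⊤ᵈ ⊥ᵈ = refl
zSplit-zNode (node _ _ _) ⊥ᵈ = refl
zSplit-zNode a ⊤ᵈ = refl
zSplit-zNode a (node _ _ _) = refl

ZDD-cofactors-injective : ∀ (𝓢 𝓣 : Family (suc n)) → ZDD 𝓢 ≡ ZDD 𝓣 →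
  ZDD (cofactor false 𝓢) ≡ ZDD (cofactor false 𝓣) × ZDD (cofactor true 𝓢) ≡ ZDD (cofactor true 𝓣)
ZDD-cofactors-injective 𝓢 𝓣 e =
  relabel-injective _ _ (cong proj₁ branches) , relabel-injective _ _ (cong proj₂ branches)
  where
  branches : (relabel (ZDD (cofactor false 𝓢)) , relabel (ZDD (cofactor true 𝓢)))
           ≡ (relabel (ZDD (cofactor false 𝓣)) , relabel (ZDD (cofactor true 𝓣)))
  branches = begin
    (relabel (ZDD (cofactor false 𝓢)) , relabel (ZDD (cofactor true 𝓢)))
      ≡⟨ zSplit-zNode _ _ ⟨
    zSplit (zNode F.zero (relabel (ZDD (cofactor false 𝓢))) (relabel (ZDD (cofactor true 𝓢))))
      ≡⟨ cong zSplit (ZDD-cofactors 𝓢) ⟨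
    zSplit (ZDD 𝓢)
      ≡⟨ cong zSplit e ⟩
    zSplit (ZDD 𝓣)
      ≡⟨ cong zSplit (ZDD-cofactors 𝓣) ⟩
    zSplit (zNode F.zero (relabel (ZDD (cofactor false 𝓣))) (relabel (ZDD (cofactor true 𝓣))))
      ≡⟨ zSplit-zNode _ _ ⟩
    (relabel (ZDD (cofactor false 𝓣)) , relabel (ZDD (cofactor true 𝓣))) ∎

ZDD-injective : ∀ (𝓢 𝓣 : Family n) → ZDD 𝓢 ≡ ZDD 𝓣 → ∀ X → 𝓢 X ≡ 𝓣 X
ZDD-injective {zero} 𝓢 𝓣 e [] with 𝓢 [] | 𝓣 []
... | false | false = refl
... | true  | true  = refl
... | false | true  with () ← e
... | true  | false with () ← e
ZDD-injective {suc n} 𝓢 𝓣 e (false ∷ X) =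
  ZDD-injective (cofactor false 𝓢) (cofactor false 𝓣) (proj₁ (ZDD-cofactors-injective 𝓢 𝓣 e)) X
ZDD-injective {suc n} 𝓢 𝓣 e (true ∷ X) =
  ZDD-injective (cofactor true 𝓢) (cofactor true 𝓣) (proj₂ (ZDD-cofactors-injective 𝓢 𝓣 e)) X

ZDD-nonempty : ∀ (𝓢 : Family n) X → T (𝓢 X) → ZDD 𝓢 ≢ ⊥ᵈ
ZDD-nonempty 𝓢 X t e =
  subst T (ZDD-injective 𝓢 (λ _ → false) (trans e (sym (ZDD-empty _ λ _ ()))) X) t

BasisExchange : Family n → Set
BasisExchange 𝓑 = ∀ B₁ B₂ → T (𝓑 B₁) → T (𝓑 B₂) →
                  ∀ x → x ∈ B₁ → x ∉ B₂ →
                  ∃ λ y → y ∈ B₂ × y ∉ B₁ × T (𝓑 ((B₁ - x) ∪ ⁅ y ⁆))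

cofactor-exchange : ∀ (b : Bool) (𝓑 : Family (suc n)) → BasisExchange 𝓑 → BasisExchange (cofactor b 𝓑)
cofactor-exchange b 𝓑 exch B₁ B₂ t₁ t₂ x x∈B₁ x∉B₂
  with exch (b ∷ B₁) (b ∷ B₂) t₁ t₂ (F.suc x) (there x∈B₁) (x∉B₂ ∘ drop-there)
... | F.suc y , there y∈B₂ , y∉B₁ , t =
  y , y∈B₂ , y∉B₁ ∘ there , subst (λ c → T (𝓑 (c ∷ _))) (∨-identityʳ b) t
cofactor-exchange false 𝓑 exch B₁ B₂ t₁ t₂ x x∈B₁ x∉B₂ | F.zero , () , _
cofactor-exchange true  𝓑 exch B₁ B₂ t₁ t₂ x x∈B₁ x∉B₂ | F.zero , _ , 0∉ , _ = ⊥-elim (0∉ here)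

cofactor-bases-disjoint : ∀ (𝓑 : Family (suc n)) → BasisExchange 𝓑 →
  ∀ B → T (𝓑 (true ∷ B)) → ¬ T (𝓑 (false ∷ B))
cofactor-bases-disjoint 𝓑 exch B t₁ t₀ with exch (true ∷ B) (false ∷ B) t₁ t₀ F.zero here (λ ())
... | F.suc y , there y∈B , y∉B , _ = y∉B (there y∈B)

exchange-shrinks-outside : ∀ {B D : Subset n} {x y} → x ∈ B → x ∉ D → y ∈ D →
  ∣ ((B - x) ∪ ⁅ y ⁆) ∩ ∁ D ∣ < ∣ B ∩ ∁ D ∣
exchange-shrinks-outside {B = B} {D} {x} {y} x∈B x∉D y∈D =
  ≤-<-trans (p⊆q⇒∣p∣≤∣q∣ shrinks) (x∈p⇒∣p-x∣<∣p∣ (x∈p∩q⁺ (x∈B , x∉p⇒x∈∁p x∉D)))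
  where
  shrinks : ((B - x) ∪ ⁅ y ⁆) ∩ ∁ D ⊆ (B ∩ ∁ D) - x
  shrinks w∈ with x∈p∩q⁻ _ _ w∈
  ... | w∈B′ , w∈∁D with x∈p∪q⁻ (B - x) ⁅ y ⁆ w∈B′
  ...   | inj₁ w∈B-x = x∈p∧x≢y⇒x∈p-y (x∈p∩q⁺ (p─q⊆p B ⁅ x ⁆ w∈B-x , w∈∁D))
                                     (x∉⁅y⁆⇒x≢y (x∈p─q⇒x∉q B ⁅ x ⁆ w∈B-x))
  ...   | inj₂ w∈⁅y⁆ with refl ← x∈⁅y⁆⇒x≡y y w∈⁅y⁆ = ⊥-elim (x∈∁p⇒x∉p w∈∁D y∈D)

-- Exchanging elements of B₁ outside D against elements of a basis B ⊆ D keeps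
-- z ∈ D and strictly decreases |B₁ ∖ D|.
containing-basis-within : ∀ (𝓑 : Family n) → BasisExchange 𝓑 →
  ∀ {B D z} → T (𝓑 B) → B ⊆ D → z ∈ D →
  ∀ B₁ → T (𝓑 B₁) → z ∈ B₁ → ∃ λ B₂ → T (𝓑 B₂) × z ∈ B₂ × B₂ ⊆ D
containing-basis-within 𝓑 exch {B} {D} {z} t B⊆D z∈D B₁ t₁ z∈B₁ =
  go B₁ t₁ z∈B₁ (<-wellFounded _)
  where
  go : ∀ B₁ → T (𝓑 B₁) → z ∈ B₁ → Acc _<_ ∣ B₁ ∩ ∁ D ∣ →
       ∃ λ B₂ → T (𝓑 B₂) × z ∈ B₂ × B₂ ⊆ D
  go B₁ t₁ z∈B₁ (acc smaller) with nonempty? (B₁ ∩ ∁ D)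
  ... | no nothing-outside = B₁ , t₁ , z∈B₁ , λ w∈B₁ →
        x∉∁p⇒x∈p λ w∈∁D → nothing-outside (_ , x∈p∩q⁺ (w∈B₁ , w∈∁D))
  ... | yes (x , x∈) with x∈p∩q⁻ B₁ (∁ D) x∈
  ...   | x∈B₁ , x∈∁D with exch B₁ B t₁ t x x∈B₁ (x∈∁p⇒x∉p x∈∁D ∘ B⊆D)
  ...     | y , y∈B , _ , t′ =
    go ((B₁ - x) ∪ ⁅ y ⁆) t′ (x∈p∪q⁺ (inj₁ (x∈p∧x≢y⇒x∈p-y z∈B₁ z≢x)))
       (smaller (exchange-shrinks-outside x∈B₁ (x∈∁p⇒x∉p x∈∁D) (B⊆D y∈B)))
    where
    z≢x : z ≢ x
    z≢x refl = x∈∁p⇒x∉p x∈∁D z∈D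

CoindependentSets : Family n → Family n → Set
CoindependentSets 𝓑 𝓘 = ∀ X → T (𝓘 X) ⇔ (∃ λ B → T (𝓑 B) × B ⊆ ∁ X)

coindependent-cofactor-true : ∀ (𝓑 𝓘 : Family (suc n)) → CoindependentSets 𝓑 𝓘 →
  CoindependentSets (cofactor false 𝓑) (cofactor true 𝓘)
coindependent-cofactor-true 𝓑 𝓘 co X = mk⇔ restrict (from (co (true ∷ X)) ∘ extend)
  where
  restrict : T (𝓘 (true ∷ X)) → ∃ λ B → T (𝓑 (false ∷ B)) × B ⊆ ∁ X
  restrict i with to (co (true ∷ X)) i
  ... | true ∷ B , _ , B⊆ with () ← B⊆ here
  ... | false ∷ B , t , B⊆ = B , t , drop-∷-⊆ B⊆
  extend : (∃ λ B → T (𝓑 (false ∷ B)) × B ⊆ ∁ X) → ∃ λ B → T (𝓑 B) × B ⊆ ∁ (true ∷ X)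
  extend (B , t , B⊆) = false ∷ B , t , out⊆ B⊆

coindependent-cofactor-false-without-0 : ∀ (𝓑 𝓘 : Family (suc n)) → CoindependentSets 𝓑 𝓘 →
  (∀ B → ¬ T (𝓑 (true ∷ B))) → CoindependentSets (cofactor false 𝓑) (cofactor false 𝓘)
coindependent-cofactor-false-without-0 𝓑 𝓘 co none X = mk⇔ restrict (from (co (false ∷ X)) ∘ extend)
  where
  restrict : T (𝓘 (false ∷ X)) → ∃ λ B → T (𝓑 (false ∷ B)) × B ⊆ ∁ X
  restrict i with to (co (false ∷ X)) i
  ... | true ∷ B , t , _ = ⊥-elim (none B t)
  ... | false ∷ B , t , B⊆ = B , t , drop-∷-⊆ B⊆
  extend : (∃ λ B → T (𝓑 (false ∷ B)) × B ⊆ ∁ X) → ∃ λ B → T (𝓑 B) × B ⊆ ∁ (false ∷ X)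
  extend (B , t , B⊆) = false ∷ B , t , out⊆ B⊆

coindependent-cofactor-false-with-0 : ∀ (𝓑 𝓘 : Family (suc n)) → BasisExchange 𝓑 →
  CoindependentSets 𝓑 𝓘 → (∃ λ B → T (𝓑 (true ∷ B))) →
  CoindependentSets (cofactor true 𝓑) (cofactor false 𝓘)
coindependent-cofactor-false-with-0 𝓑 𝓘 exch co (B₀ , t₀) X = mk⇔ restrict (from (co (false ∷ X)) ∘ extend)
  where
  restrict : T (𝓘 (false ∷ X)) → ∃ λ B → T (𝓑 (true ∷ B)) × B ⊆ ∁ X
  restrict i with to (co (false ∷ X)) i
  ... | B , t , B⊆ with containing-basis-within 𝓑 exch t B⊆ here (true ∷ B₀) t₀ here
  ...   | true ∷ B₂ , t₂ , _ , B₂⊆ = B₂ , t₂ , drop-∷-⊆ B₂⊆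
  extend : (∃ λ B → T (𝓑 (true ∷ B)) × B ⊆ ∁ X) → ∃ λ B → T (𝓑 B) × B ⊆ ∁ (false ∷ X)
  extend (B , t , B⊆) = true ∷ B , t , s⊆s B⊆

dualIndependent-coindependent : ∀ (M : Matroid n) → CoindependentSets (isBasis M) (dualIndependent M)
dualIndependent-coindependent M X = mk⇔ to′ from′
  where
  to′ : T (dualIndependent M X) → ∃ λ B → T (isBasis M B) × B ⊆ ∁ X
  to′ i with toWitness i
  ... | B , t , X⊆B = ∁ B , t , p⊆q⇒∁p⊇∁q X⊆B
  from′ : (∃ λ B → T (isBasis M B) × B ⊆ ∁ X) → T (dualIndependent M X)
  from′ (B , t , B⊆∁X) = fromWitness (∁ B , t′ , λ {x} → X⊆∁B {x})
    where
    t′ : T (isBasis M (∁ (∁ B)))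
    t′ = subst (T ∘ isBasis M) (sym (¬-involutive (∪-∩-booleanAlgebra _) B)) t
    X⊆∁B : X ⊆ ∁ B
    X⊆∁B x∈X = x∉p⇒x∈∁p λ x∈B → x∈p⇒x∉∁p x∈X (B⊆∁X x∈B)

BDD-coindependent≡swapArcs-ZDD-base : ∀ (𝓑 𝓘 : Family 0) → CoindependentSets 𝓑 𝓘 →
  BDD 𝓘 ≡ swapArcs (ZDD 𝓑)
BDD-coindependent≡swapArcs-ZDD-base 𝓑 𝓘 co
  rewrite T-⇔⇒≡ (mk⇔ ((λ { ([] , t , _) → t }) ∘ to (co [])) (λ t → from (co []) ([] , t , λ ())))
  with 𝓑 []
... | false = refl
... | true  = refl

module _ (𝓑 𝓘 : Family (suc n)) (exch : BasisExchange 𝓑) (co : CoindependentSets 𝓑 𝓘)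
         (IH : ∀ (𝓑′ 𝓘′ : Family n) → BasisExchange 𝓑′ → CoindependentSets 𝓑′ 𝓘′ →
               BDD 𝓘′ ≡ swapArcs (ZDD 𝓑′))
  where

  private
    𝓑₀ 𝓑₁ 𝓘₀ 𝓘₁ : Family n
    𝓑₀ = cofactor false 𝓑
    𝓑₁ = cofactor true 𝓑
    𝓘₀ = cofactor false 𝓘
    𝓘₁ = cofactor true 𝓘
    Z₀ Z₁ : DD n
    Z₀ = ZDD 𝓑₀
    Z₁ = ZDD 𝓑₁

    BDD-𝓘₁ : BDD 𝓘₁ ≡ swapArcs Z₀
    BDD-𝓘₁ = IH 𝓑₀ 𝓘₁ (cofactor-exchange false 𝓑 exch) (coindependent-cofactor-true 𝓑 𝓘 co)

  BDD-coindependent-step-without-0 : (∀ B → ¬ T (𝓑₁ B)) → BDD 𝓘 ≡ swapArcs (ZDD 𝓑)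
  BDD-coindependent-step-without-0 none = begin
    BDD 𝓘
      ≡⟨ BDD-cofactors 𝓘 ⟩
    bNode F.zero (relabel (BDD 𝓘₀)) (relabel (BDD 𝓘₁))
      ≡⟨ cong₂ (λ a b → bNode F.zero (relabel a) (relabel b)) BDD-𝓘₀ BDD-𝓘₁ ⟩
    bNode F.zero (relabel (swapArcs Z₀)) (relabel (swapArcs Z₀))
      ≡⟨ bNode-same F.zero _ ⟩
    relabel (swapArcs Z₀)
      ≡⟨ swapArcs-relabel Z₀ ⟨
    swapArcs (zNode F.zero (relabel Z₀) (relabel ⊥ᵈ))
      ≡⟨ cong (λ z → swapArcs (zNode F.zero (relabel Z₀) (relabel z))) (ZDD-empty 𝓑₁ none) ⟨
    swapArcs (zNode F.zero (relabel Z₀) (relabel Z₁))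
      ≡⟨ cong swapArcs (ZDD-cofactors 𝓑) ⟨
    swapArcs (ZDD 𝓑) ∎
    where
    BDD-𝓘₀ : BDD 𝓘₀ ≡ swapArcs Z₀
    BDD-𝓘₀ = IH 𝓑₀ 𝓘₀ (cofactor-exchange false 𝓑 exch)
                (coindependent-cofactor-false-without-0 𝓑 𝓘 co none)

  BDD-coindependent-step-with-0 : ∀ B → T (𝓑₁ B) → BDD 𝓘 ≡ swapArcs (ZDD 𝓑)
  BDD-coindependent-step-with-0 B t = begin
    BDD 𝓘
      ≡⟨ BDD-cofactors 𝓘 ⟩
    bNode F.zero (relabel (BDD 𝓘₀)) (relabel (BDD 𝓘₁))
      ≡⟨ cong₂ (λ a b → bNode F.zero (relabel a) (relabel b)) BDD-𝓘₀ BDD-𝓘₁ ⟩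
    bNode F.zero (relabel (swapArcs Z₁)) (relabel (swapArcs Z₀))
      ≡⟨ bNode-distinct F.zero _ _ branches-differ ⟩
    node F.zero (relabel (swapArcs Z₁)) (relabel (swapArcs Z₀))
      ≡⟨ cong₂ (node F.zero) (swapArcs-relabel Z₁) (swapArcs-relabel Z₀) ⟨
    swapArcs (node F.zero (relabel Z₀) (relabel Z₁))
      ≡⟨ cong swapArcs (zNode-nonempty F.zero _ _ (ZDD-nonempty 𝓑₁ B t ∘ relabel-injective Z₁ ⊥ᵈ)) ⟨
    swapArcs (zNode F.zero (relabel Z₀) (relabel Z₁))
      ≡⟨ cong swapArcs (ZDD-cofactors 𝓑) ⟨
    swapArcs (ZDD 𝓑) ∎
    where
    BDD-𝓘₀ : BDD 𝓘₀ ≡ swapArcs Z₁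
    BDD-𝓘₀ = IH 𝓑₁ 𝓘₀ (cofactor-exchange true 𝓑 exch)
                (coindependent-cofactor-false-with-0 𝓑 𝓘 exch co (B , t))
    branches-differ : relabel (swapArcs Z₁) ≢ relabel (swapArcs Z₀)
    branches-differ e = cofactor-bases-disjoint 𝓑 exch B t
      (subst T (ZDD-injective 𝓑₁ 𝓑₀ (swapArcs-injective Z₁ Z₀ (relabel-injective _ _ e)) B) t)

BDD-coindependent≡swapArcs-ZDD : ∀ n (𝓑 𝓘 : Family n) → BasisExchange 𝓑 → CoindependentSets 𝓑 𝓘 →
  BDD 𝓘 ≡ swapArcs (ZDD 𝓑)
BDD-coindependent≡swapArcs-ZDD zero 𝓑 𝓘 _ co = BDD-coindependent≡swapArcs-ZDD-base 𝓑 𝓘 co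
BDD-coindependent≡swapArcs-ZDD (suc n) 𝓑 𝓘 exch co
  with anySubset? (T? ∘ cofactor true 𝓑)
... | no  none    = BDD-coindependent-step-without-0 𝓑 𝓘 exch co IH (λ B t → none (B , t))
  where IH = BDD-coindependent≡swapArcs-ZDD n
... | yes (B , t) = BDD-coindependent-step-with-0 𝓑 𝓘 exch co IH B t
  where IH = BDD-coindependent≡swapArcs-ZDD n

theorem3p6 : ∀ (n : ℕ) (M : Matroid n) →
    BDD (dualIndependent M) ≡ swapArcs (ZDD (isBasis M))
theorem3p6 n M =
  BDD-coindependent≡swapArcs-ZDD n (isBasis M) (dualIndependent M) (exchange M) (dualIndependent-coindependent M)
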